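{- Let $n\ge 2$ and let $\mathbf{u},\mathbf{v}\in\{0,1\}^n$ be such that $\mathbf{u}$ is $1$-dominant over $\mathbf{v}$, and suppose $\mathbf{v}\neq 0^n$ and $\mathbf{v}\neq 1^n$. Then there exist $\{p,q\}=\{0,1\}$ and an integer $m$ with $1\le m\le n-1$ such that $\mathbf{u}=p^{m-1}qpq^{n-m-1}$ and $\mathbf{v}=p^mq^{n-m}$.
   Context: For a binary vector $\mathbf{u}$ of length $n$ and $t\le n$, $D_t(\mathbf{u})$ denotes the set of all vectors of length $n-t$ obtained from $\mathbf{u}$ by deleting $t$ entries (i.e. all subsequences of $\mathbf{u}$ of length $n-t$). A vector $\mathbf{u}$ is called $t$-dominant over $\mathbf{v}$ (both of length $n$) if $\mathbf{u}\neq\mathbf{v}$ and $D_t(\mathbf{v})\subseteq D_t(\mathbf{u})$. For a symbol $p\in\{0,1\}$ and an integer $a\ge 0$, $p^a$ denotes the string of $a$ copies of $p$ ($p^0$ is empty), and juxtaposition denotes concatenation. -}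

module Defs where

open import Data.Bool using (Bool)
open import Data.Nat using (ℕ; _∸_)
open import Data.Vec using (Vec; []; _∷_)
open import Data.Product using (_×_)
open import Relation.Binary.PropositionalEquality using (_≢_)

data Subseq {A : Set} : {m n : ℕ} → Vec A m → Vec A n → Set where
  []   : Subseq [] []
  keep : ∀ {m n} (x : A) {w : Vec A m} {u : Vec A n} → Subseq w u → Subseq (x ∷ w) (x ∷ u)
  drop : ∀ {m n} (x : A) {w : Vec A m} {u : Vec A n} → Subseq w u → Subseq w (x ∷ u)

D : {n : ℕ} (t : ℕ) → Vec Bool n → Vec Bool (n ∸ t) → Set
D t u w = Subseq w u

-- u is t-dominant over v : u ≠ v and D_t(v) ⊆ D_t(u)  (meaningful for t ≤ n)
Dominant : {n : ℕ} (t : ℕ) → Vec Bool n → Vec Bool n → Set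
Dominant {n} t u v = (u ≢ v) × (∀ (w : Vec Bool (n ∸ t)) → D t v w → D t u w)

-- Compare u = a ∷ u′ and v = b ∷ v′ at their first letters.  If a ≠ b, every deletion w of v′ gives
-- b ∷ w ∈ D₁(v) ⊆ D₁(u), which forces b ∷ w = u′; so v′ has a single one-deletion, hence is constant,
-- and as v is not constant, v = b aᵏ⁺¹ and u = a b aᵏ.  If a = b, the deletion v′ of v lies in D₁(u)
-- and differs from u′, so v′ also starts with a; then u′ is 1-dominant over the non-constant v′,
-- and the shape found for (u′, v′) extends by one more leading a.
module Submission where

open import Defs
open import Data.Bool using (Bool; true; false; not; _≟_)
open import Data.Bool.Properties using (¬-not)
open import Data.Nat using (ℕ; zero; suc; _≤_; _∸_; z≤n; s≤s)
open import Data.Nat.Properties using (m≤n⇒m≤1+n; n≮n)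
open import Data.Vec using (Vec; []; _∷_; head; tail; replicate; toList)
open import Data.List using (_∷_; _++_)
open import Data.List.Properties using (∷-injectiveˡ)
open import Data.Product using (_×_; _,_; ∃-syntax)
open import Data.Empty using (⊥-elim)
open import Relation.Nullary using (yes; no)
open import Relation.Binary.PropositionalEquality
  using (_≡_; _≢_; refl; sym; trans; cong; cong₂; subst; subst₂)

private
  variable
    A : Set
    k m n : ℕ

Subseq-refl : (x : Vec A n) → Subseq x x
Subseq-refl []      = []
Subseq-refl (a ∷ x) = keep a (Subseq-refl x)

Subseq-length : {w : Vec A m} {x : Vec A n} → Subseq w x → m ≤ n
Subseq-length []         = z≤n
Subseq-length (keep _ s) = s≤s (Subseq-length s)
Subseq-length (drop _ s) = m≤n⇒m≤1+n (Subseq-length s)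

Subseq-sameLength⇒≡ : {w x : Vec A n} → Subseq w x → w ≡ x
Subseq-sameLength⇒≡ []                         = refl
Subseq-sameLength⇒≡ (keep a s)                 = cong (a ∷_) (Subseq-sameLength⇒≡ s)
Subseq-sameLength⇒≡ {n = suc n} (drop _ s) = ⊥-elim (n≮n n (Subseq-length s))

_⊆₁_ : Vec A (suc n) → Vec A (suc n) → Set
_⊆₁_ {n = n} v u = (w : Vec _ n) → Subseq w v → Subseq w u

⊆₁-tail : ∀ {a} {u v : Vec A (suc n)} → (a ∷ v) ⊆₁ (a ∷ u) → v ⊆₁ u
⊆₁-tail {a = a} dom w s with dom (a ∷ w) (keep a s)
... | keep _ s′ = s′
... | drop _ s′ = subst (Subseq w) (Subseq-sameLength⇒≡ s′) (drop a (Subseq-refl w))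

⊆₁-sameHead : ∀ {a} {u v : Vec A (suc n)} → u ≢ v → (a ∷ v) ⊆₁ (a ∷ u) → head v ≡ a
⊆₁-sameHead {a = a} {v = v} u≢v dom with dom v (drop a (Subseq-refl v))
... | keep _ _ = refl
... | drop _ s = ⊥-elim (u≢v (sym (Subseq-sameLength⇒≡ s)))

⊆₁-headMismatch : ∀ {a b} {u v : Vec A (suc k)} → a ≢ b → (b ∷ v) ⊆₁ (a ∷ u) →
  (w : Vec A k) → Subseq w v → b ∷ w ≡ u
⊆₁-headMismatch {b = b} a≢b dom w s with dom (b ∷ w) (keep b s)
... | keep _ _  = ⊥-elim (a≢b refl)
... | drop _ s′ = Subseq-sameLength⇒≡ s′

uniqueDeletion⇒replicate : (y : Vec A (suc k)) (w₀ : Vec A k) →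
  ((w : Vec A k) → Subseq w y → w ≡ w₀) → y ≡ replicate (suc k) (head y)
uniqueDeletion⇒replicate (c ∷ []) _ _ = refl
uniqueDeletion⇒replicate (c ∷ d ∷ y) w₀ unique = cong (c ∷_) tail-constant
  where
  c≡d : c ≡ d
  c≡d = cong head (trans (unique (c ∷ y) (keep c (drop d (Subseq-refl y))))
                         (sym (unique (d ∷ y) (drop c (Subseq-refl (d ∷ y))))))

  tail-constant : d ∷ y ≡ replicate _ c
  tail-constant = trans
    (uniqueDeletion⇒replicate (d ∷ y) (tail w₀) (λ w s → cong tail (unique (c ∷ w) (keep c s))))
    (cong (replicate _) (sym c≡d))

NonConstant : Vec A n → Set
NonConstant {n = n} v = ∀ c → v ≢ replicate n c

NonConstant-tail : ∀ {a} {v : Vec A (suc n)} → NonConstant (a ∷ v) → head v ≡ a → NonConstant v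
NonConstant-tail nc head≡a c v≡cs = nc c (cong₂ _∷_ (trans (sym head≡a) (cong head v≡cs)) v≡cs)

-- v = pᵐ qⁿ⁻ᵐ and u arises from v by swapping its letters at positions m and m + 1.
SwappedStep : (n : ℕ) → Vec Bool n → Vec Bool n → Set
SwappedStep n u v = ∃[ p ] ∃[ q ] ∃[ m ] (q ≡ not p × 1 ≤ m × m ≤ n ∸ 1 ×
  toList u ≡ toList (replicate (m ∸ 1) p) ++ q ∷ p ∷ toList (replicate (n ∸ m ∸ 1) q) ×
  toList v ≡ toList (replicate m p) ++ toList (replicate (n ∸ m) q))

swappedStep-cons : ∀ {a} {u v : Vec Bool (suc n)} → head v ≡ a →
  SwappedStep (suc n) u v → SwappedStep (suc (suc n)) (a ∷ u) (a ∷ v)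
swappedStep-cons {v = x ∷ v} refl (p , q , suc m , q≡¬p , _ , m<n , u≡ , v≡)
  with ∷-injectiveˡ v≡
... | refl = p , q , suc (suc m) , q≡¬p , s≤s z≤n , s≤s m<n , cong (p ∷_) u≡ , cong (p ∷_) v≡

headMismatch⇒swappedStep : ∀ {a b} {u v : Vec Bool (suc k)} → a ≢ b → (b ∷ v) ⊆₁ (a ∷ u) →
  NonConstant (b ∷ v) → SwappedStep (suc (suc k)) (a ∷ u) (b ∷ v)
headMismatch⇒swappedStep {k} {a} {b} {u} {v} a≢b dom nc =
  subst₂ (λ x y → SwappedStep _ (a ∷ x) (b ∷ y)) (sym u≡) (sym v≡)
    (b , a , 1 , ¬-not a≢b , s≤s z≤n , s≤s z≤n , refl , refl)
  where
  v-constant : v ≡ replicate (suc k) (head v)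
  v-constant = uniqueDeletion⇒replicate v (tail u)
    (λ w s → cong tail (⊆₁-headMismatch a≢b dom w s))

  head-v≢b : head v ≢ b
  head-v≢b h≡b = nc b (cong (b ∷_) (subst (λ c → v ≡ replicate _ c) h≡b v-constant))

  v≡ : v ≡ replicate (suc k) a
  v≡ = trans v-constant (cong (replicate _) (trans (¬-not head-v≢b) (sym (¬-not a≢b))))

  u≡ : u ≡ b ∷ replicate k a
  u≡ = sym (⊆₁-headMismatch a≢b dom (replicate k a)
         (subst (Subseq (replicate k a)) (sym v≡) (drop a (Subseq-refl _))))

dominant⇒swappedStep : {u v : Vec Bool (suc n)} → u ≢ v → v ⊆₁ u → NonConstant v →
  SwappedStep (suc n) u v
dominant⇒swappedStep {u = a ∷ []} {b ∷ []} _ _ nc = ⊥-elim (nc b refl)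
dominant⇒swappedStep {u = a ∷ u@(_ ∷ _)} {b ∷ v@(_ ∷ _)} u≢v dom nc with a ≟ b
... | no a≢b   = headMismatch⇒swappedStep a≢b dom nc
... | yes refl = swappedStep-cons head-v≡a
      (dominant⇒swappedStep tail-u≢v (⊆₁-tail dom) (NonConstant-tail nc head-v≡a))
  where
  tail-u≢v : u ≢ v
  tail-u≢v u≡v = u≢v (cong (a ∷_) u≡v)

  head-v≡a : head v ≡ a
  head-v≡a = ⊆₁-sameHead tail-u≢v dom

proposition2 : (n : ℕ) → 2 ≤ n → (u v : Vec Bool n) → Dominant 1 u v →
    v ≢ replicate n false → v ≢ replicate n true →
    ∃[ p ] ∃[ q ] ∃[ m ] (q ≡ not p × 1 ≤ m × m ≤ n ∸ 1 ×
    toList u ≡ toList (replicate (m ∸ 1) p) ++ q ∷ p ∷ toList (replicate (n ∸ m ∸ 1) q) ×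
    toList v ≡ toList (replicate m p) ++ toList (replicate (n ∸ m) q))
proposition2 (suc n) _ u v (u≢v , dom) v≢0ⁿ v≢1ⁿ = dominant⇒swappedStep u≢v dom nonConstant
  where
  nonConstant : NonConstant v
  nonConstant false = v≢0ⁿ
  nonConstant true  = v≢1ⁿ
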